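{- Let $w\in\mathcal{M}$ be a rising word. Then there exists a unique up-normal word $t\in\mathcal{M}$ such that $t\overset{\mathrm{bal}}{\sim} w$.
   Context: $\mathcal{M}$ is the free monoid on letters $D,U$. A word is balanced if it has equally many $D$'s and $U$'s, and rising if it has at least as many $U$'s as $D$'s. A down-zig is a word $UD^kU$ with $k\ge 2$. A rising word is up-normal if no down-zig occurs as a factor (contiguous subword). A balanced commutation turns $pyxq$ into $pxyq$ for words $p,q$ and balanced words $x,y$; $\overset{\mathrm{bal}}{\sim}$ is the equivalence relation "obtainable by a finite (possibly empty) sequence of balanced commutations". -}

module Defs where

open import Data.Nat using (ℕ; zero; suc; _≤_)
open import Data.List using (List; []; _∷_; _++_; replicate; filter; length)
open import Data.Product using (Σ; ∃; _×_; _,_)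
open import Relation.Binary.PropositionalEquality using (_≡_)
open import Relation.Binary.Construct.Closure.ReflexiveTransitive using (Star)
open import Relation.Nullary using (¬_)

data Letter : Set where
  D U : Letter

Word : Set
Word = List Letter

#D : Word → ℕ
#D []      = 0
#D (D ∷ w) = suc (#D w)
#D (U ∷ w) = #D w

#U : Word → ℕ
#U []      = 0
#U (D ∷ w) = #U w
#U (U ∷ w) = suc (#U w)

Balanced : Word → Set
Balanced w = #D w ≡ #U w

Rising : Word → Set
Rising w = #D w ≤ #U w

Factor : Word → Word → Set
Factor z w = Σ Word λ p → Σ Word λ q → w ≡ p ++ z ++ q

DownZig : Word → Set
DownZig z = Σ ℕ λ k → (2 ≤ k) × (z ≡ U ∷ (replicate k D ++ U ∷ []))

UpNormal : Word → Set
UpNormal w = Rising w × (∀ z → DownZig z → ¬ Factor z w)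

data BalComm : Word → Word → Set where
  bal-comm : ∀ p q x y → Balanced x → Balanced y →
             BalComm (p ++ y ++ x ++ q) (p ++ x ++ y ++ q)

_∼bal_ : Word → Word → Set
u ∼bal v = Star BalComm u v

{-# OPTIONS --safe #-}
-- Read a word as a lattice path (U up, D down).  A balanced factor returns to its starting
-- height, so swapping two of them preserves the number of D's and, for every height j, the
-- number of up-steps leaving height j.  These data determine a zig-free word: if two zig-free
-- paths from the same height h first differ by a D against a U, the one going up never steps
-- up from below h (after U D D no U may follow), so by the equal counts neither does the one
-- going down; but a path that starts below h reaches h only through such an up-step, and it
-- must account for the up-step the other path takes from h.  A leading D is kept; a leading U is kept unless
-- the normalised tail starts with D D, in which case U D D Q U ∼ D Q U U D for the shortest
-- balanced prefix Q of the rest; and if the tail is not rising then the word is U B D v with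
-- B and v balanced, which commutes to v U B D.
module Submission where

open import Defs
open import Data.Bool.Base using (if_then_else_)
open import Data.Empty using (⊥-elim)
open import Data.Integer as ℤ using (ℤ; +_; 0ℤ; 1ℤ)
import Data.Integer.Properties as ℤP
open import Data.Integer.Tactic.RingSolver using (solve-∀)
open import Data.List using ([]; _∷_; _++_; replicate; length; _∷ʳ_; initLast; _∷ʳ′_)
open import Data.List.Properties using (++-assoc; ++-identityʳ; length-++; ∷-injectiveʳ; ∷ʳ-injective)
open import Data.Nat using (ℕ; zero; suc; _+_; _≤_; _<_; s≤s; s≤s⁻¹)
import Data.Nat.Properties as ℕP
open import Data.Nat.Induction using (<-wellFounded)
open import Data.Product using (Σ; _×_; _,_; proj₁; proj₂)
open import Data.Sum using (_⊎_; inj₁; inj₂)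
open import Function.Base using (_∘_)
open import Induction.WellFounded using (module All)
open import Relation.Binary.Construct.Closure.ReflexiveTransitive using (ε; _◅_; _◅◅_; gmap; reverse)
open import Relation.Binary.Construct.On as On using ()
open import Relation.Binary.PropositionalEquality
open import Relation.Nullary using (¬_; does; yes; no)
open import Relation.Nullary.Decidable using (dec-true; dec-false)
open import Algebra.Properties.CommutativeSemigroup ℕP.+-commutativeSemigroup using (x∙yz≈y∙xz)

open ≡-Reasoning

#D-++ : ∀ a b → #D (a ++ b) ≡ #D a + #D b
#D-++ []      b = refl
#D-++ (D ∷ a) b = cong suc (#D-++ a b)
#D-++ (U ∷ a) b = #D-++ a b

#U-++ : ∀ a b → #U (a ++ b) ≡ #U a + #U b
#U-++ []      b = refl
#U-++ (D ∷ a) b = #U-++ a b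
#U-++ (U ∷ a) b = cong suc (#U-++ a b)

#D-∷ʳ : ∀ w c → #D (w ∷ʳ c) ≡ #D (c ∷ w)
#D-∷ʳ w c = trans (#D-++ w (c ∷ [])) (trans (ℕP.+-comm (#D w) _) (sym (#D-++ (c ∷ []) w)))

#U-∷ʳ : ∀ w c → #U (w ∷ʳ c) ≡ #U (c ∷ w)
#U-∷ʳ w c = trans (#U-++ w (c ∷ [])) (trans (ℕP.+-comm (#U w) _) (sym (#U-++ (c ∷ []) w)))

balanced-D∷-∷ʳU : ∀ Q → Balanced Q → Balanced (D ∷ Q ∷ʳ U)
balanced-D∷-∷ʳU Q bal = trans (cong suc (trans (#D-∷ʳ Q U) bal)) (sym (#U-∷ʳ Q U))

balanced-U∷-∷ʳD : ∀ B → Balanced B → Balanced (U ∷ B ∷ʳ D)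
balanced-U∷-∷ʳD B bal = trans (#D-∷ʳ B D) (cong suc (trans bal (sym (#U-∷ʳ B D))))

balanced-++⁻ʳ : ∀ a b → Balanced a → Balanced (a ++ b) → Balanced b
balanced-++⁻ʳ a b bal-a bal-ab = ℕP.+-cancelˡ-≡ (#U a) _ _ (begin
  #U a + #D b  ≡⟨ cong (_+ #D b) bal-a ⟨
  #D a + #D b  ≡⟨ #D-++ a b ⟨
  #D (a ++ b)  ≡⟨ bal-ab ⟩
  #U (a ++ b)  ≡⟨ #U-++ a b ⟩
  #U a + #U b  ∎)

balanced-∷ʳD⇒rising : ∀ Y → Balanced (Y ∷ʳ D) → Rising Y
balanced-∷ʳD⇒rising Y bal =
  ℕP.<⇒≤ (ℕP.≤-reflexive (trans (sym (#D-∷ʳ Y D)) (trans bal (#U-∷ʳ Y D))))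

split-first-excess-D : ∀ n v → n + #U v < #D v →
  Σ Word λ P → Σ Word λ v′ → v ≡ P ++ D ∷ v′ × #D P ≡ n + #U P
split-first-excess-D zero    (D ∷ v) _  = [] , v , refl , refl
split-first-excess-D (suc n) (D ∷ v) lt with split-first-excess-D n v (s≤s⁻¹ lt)
... | P , v′ , refl , exc = D ∷ P , v′ , refl , cong suc exc
split-first-excess-D n       (U ∷ v) lt
  with split-first-excess-D (suc n) v (subst (_< #D v) (ℕP.+-suc n (#U v)) lt)
... | P , v′ , refl , exc = U ∷ P , v′ , refl , trans exc (sym (ℕP.+-suc n (#U P)))

split-first-excess-U : ∀ n v → n + #D v < #U v →
  Σ Word λ P → Σ Word λ v′ → v ≡ P ++ U ∷ v′ × #U P ≡ n + #D P
split-first-excess-U zero    (U ∷ v) _  = [] , v , refl , refl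
split-first-excess-U (suc n) (U ∷ v) lt with split-first-excess-U n v (s≤s⁻¹ lt)
... | P , v′ , refl , exc = U ∷ P , v′ , refl , cong suc exc
split-first-excess-U n       (D ∷ v) lt
  with split-first-excess-U (suc n) v (subst (_< #U v) (ℕP.+-suc n (#D v)) lt)
... | P , v′ , refl , exc = D ∷ P , v′ , refl , trans exc (sym (ℕP.+-suc n (#D P)))

end : ℤ → Word → ℤ
end s []      = s
end s (D ∷ w) = end (ℤ.pred s) w
end s (U ∷ w) = end (ℤ.suc s) w

δ : ℤ → ℤ → ℕ
δ i j = if does (i ℤ.≟ j) then 1 else 0

ups : ℤ → Word → ℤ → ℕ
ups s []      j = 0
ups s (D ∷ w) j = ups (ℤ.pred s) w j
ups s (U ∷ w) j = δ s j + ups (ℤ.suc s) w j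

δ-refl : ∀ i → δ i i ≡ 1
δ-refl i = cong (if_then 1 else 0) (dec-true (i ℤ.≟ i) refl)

δ-≢ : ∀ {i j} → i ≢ j → δ i j ≡ 0
δ-≢ {i} {j} i≢j = cong (if_then 1 else 0) (dec-false (i ℤ.≟ j) i≢j)

end-≡ : ∀ s w → end s w ≡ s ℤ.+ (+ #U w ℤ.- + #D w)
end-≡ s []      = sym (ℤP.+-identityʳ s)
end-≡ s (D ∷ w) = trans (end-≡ (ℤ.pred s) w) (down s (+ #U w) (+ #D w))
  where
  down : ∀ s a b → (ℤ.-1ℤ ℤ.+ s) ℤ.+ (a ℤ.- b) ≡ s ℤ.+ (a ℤ.- (1ℤ ℤ.+ b))
  down = solve-∀
end-≡ s (U ∷ w) = trans (end-≡ (ℤ.suc s) w) (up s (+ #U w) (+ #D w))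
  where
  up : ∀ s a b → (1ℤ ℤ.+ s) ℤ.+ (a ℤ.- b) ≡ s ℤ.+ ((1ℤ ℤ.+ a) ℤ.- b)
  up = solve-∀

end-balanced : ∀ s x → Balanced x → end s x ≡ s
end-balanced s x bal = begin
  end s x                    ≡⟨ end-≡ s x ⟩
  s ℤ.+ (+ #U x ℤ.- + #D x)  ≡⟨ cong (λ n → s ℤ.+ (+ #U x ℤ.- + n)) bal ⟩
  s ℤ.+ (+ #U x ℤ.- + #U x)  ≡⟨ cong (λ u → s ℤ.+ u) (ℤP.+-inverseʳ (+ #U x)) ⟩
  s ℤ.+ 0ℤ                   ≡⟨ ℤP.+-identityʳ s ⟩
  s                          ∎

Additive : (ℤ → Word → ℕ) → Set
Additive φ = ∀ s a b → φ s (a ++ b) ≡ φ s a + φ (end s a) b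

ups-additive : ∀ j → Additive (λ s w → ups s w j)
ups-additive j s []      b = refl
ups-additive j s (D ∷ a) b = ups-additive j (ℤ.pred s) a b
ups-additive j s (U ∷ a) b =
  trans (cong (_+_ (δ s j)) (ups-additive j (ℤ.suc s) a b)) (sym (ℕP.+-assoc (δ s j) _ _))

module _ {φ : ℤ → Word → ℕ} (φ-++ : Additive φ) where

  private
    φ-balanced-++ : ∀ s x r → Balanced x → φ s (x ++ r) ≡ φ s x + φ s r
    φ-balanced-++ s x r bal =
      trans (φ-++ s x r) (cong (λ e → φ s x + φ e r) (end-balanced s x bal))

    φ-split : ∀ s x y q → Balanced x → Balanced y → φ s (y ++ x ++ q) ≡ φ s y + (φ s x + φ s q)
    φ-split s x y q bx by =
      trans (φ-balanced-++ s y _ by) (cong (_+_ (φ s y)) (φ-balanced-++ s x q bx))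

  additive-balComm : ∀ {u v} → BalComm u v → ∀ s → φ s u ≡ φ s v
  additive-balComm (bal-comm p q x y bx by) s = begin
    φ s (p ++ y ++ x ++ q)             ≡⟨ φ-++ s p _ ⟩
    φ s p + φ e (y ++ x ++ q)          ≡⟨ cong (_+_ (φ s p)) (φ-split e x y q bx by) ⟩
    φ s p + (φ e y + (φ e x + φ e q))  ≡⟨ cong (_+_ (φ s p)) (x∙yz≈y∙xz (φ e y) (φ e x) (φ e q)) ⟩
    φ s p + (φ e x + (φ e y + φ e q))  ≡⟨ cong (_+_ (φ s p)) (φ-split e y x q by bx) ⟨
    φ s p + φ e (x ++ y ++ q)          ≡⟨ φ-++ s p _ ⟨
    φ s (p ++ x ++ y ++ q)             ∎
    where e = end s p

  additive-∼bal : ∀ {u v} → u ∼bal v → ∀ s → φ s u ≡ φ s v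
  additive-∼bal ε          s = refl
  additive-∼bal (st ◅ sts) s = trans (additive-balComm st s) (additive-∼bal sts s)

#D-∼bal : ∀ {u v} → u ∼bal v → #D u ≡ #D v
#D-∼bal u∼v = additive-∼bal {λ _ → #D} (λ _ → #D-++) u∼v 0ℤ

#U-∼bal : ∀ {u v} → u ∼bal v → #U u ≡ #U v
#U-∼bal u∼v = additive-∼bal {λ _ → #U} (λ _ → #U-++) u∼v 0ℤ

length-∼bal : ∀ {u v} → u ∼bal v → length u ≡ length v
length-∼bal u∼v = additive-∼bal {λ _ → length} (λ _ a _ → length-++ a) u∼v 0ℤ

ups-∼bal : ∀ {u v} → u ∼bal v → ∀ s j → ups s u j ≡ ups s v j
ups-∼bal u∼v s j = additive-∼bal (ups-additive j) u∼v s

rising-∼bal : ∀ {u v} → u ∼bal v → Rising v → Rising u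
rising-∼bal u∼v = subst₂ _≤_ (sym (#D-∼bal u∼v)) (sym (#U-∼bal u∼v))

balanced-∼bal : ∀ {u v} → u ∼bal v → Balanced v → Balanced u
balanced-∼bal u∼v = subst₂ _≡_ (sym (#D-∼bal u∼v)) (sym (#U-∼bal u∼v))

balComm-sym : ∀ {u v} → BalComm u v → BalComm v u
balComm-sym (bal-comm p q x y bx by) = bal-comm p q y x by bx

∼bal-sym : ∀ {u v} → u ∼bal v → v ∼bal u
∼bal-sym = reverse balComm-sym

∷-∼bal : ∀ c {u v} → u ∼bal v → (c ∷ u) ∼bal (c ∷ v)
∷-∼bal c = gmap (c ∷_) λ { (bal-comm p q x y bx by) → bal-comm (c ∷ p) q x y bx by }

++ʳ-∼bal : ∀ r {u v} → u ∼bal v → (u ++ r) ∼bal (v ++ r)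
++ʳ-∼bal r = gmap (_++ r) λ { (bal-comm p q x y bx by) →
  subst₂ BalComm (sym (assoc₄ p y x q)) (sym (assoc₄ p x y q)) (bal-comm p (q ++ r) x y bx by) }
  where
  assoc₄ : ∀ p y x q → (p ++ y ++ x ++ q) ++ r ≡ p ++ y ++ x ++ q ++ r
  assoc₄ p y x q =
    trans (++-assoc p _ r) (cong (p ++_) (trans (++-assoc y _ r) (cong (y ++_) (++-assoc x q r))))

descent-commutation : ∀ Q Z → Balanced Q →
  BalComm (D ∷ Q ++ U ∷ U ∷ D ∷ Z) (U ∷ D ∷ D ∷ Q ++ U ∷ Z)
descent-commutation Q Z bal =
  subst₂ BalComm
    (cong (D ∷_) (++-assoc Q (U ∷ []) _))
    (cong (λ u → U ∷ D ∷ D ∷ u) (++-assoc Q (U ∷ []) Z))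
    (bal-comm [] Z (U ∷ D ∷ []) (D ∷ Q ∷ʳ U) refl (balanced-D∷-∷ʳU Q bal))

rotation-commutation : ∀ B v → Balanced B → Balanced v →
  BalComm ((v ++ U ∷ B) ∷ʳ D) (U ∷ B ++ D ∷ v)
rotation-commutation B v bal-B bal-v =
  subst₂ BalComm
    (trans (cong (v ++_) (++-identityʳ _)) (sym (++-assoc v (U ∷ B) (D ∷ []))))
    (cong (U ∷_) (trans (++-assoc B (D ∷ []) _) (cong (λ u → B ++ D ∷ u) (++-identityʳ v))))
    (bal-comm [] [] (U ∷ B ∷ʳ D) v (balanced-U∷-∷ʳD B bal-B) bal-v)

ZigFree : Word → Set
ZigFree w = ∀ z → DownZig z → ¬ Factor z w

zigFree-[] : ZigFree []
zigFree-[] _ (_ , _ , refl) ([]    , _ , ())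
zigFree-[] _ (_ , _ , refl) (_ ∷ _ , _ , ())

zigFree-tail : ∀ c {w} → ZigFree (c ∷ w) → ZigFree w
zigFree-tail c zf z dz (p , q , eq) = zf z dz (c ∷ p , q , cong (c ∷_) eq)

zigFree-D∷ : ∀ {w} → ZigFree w → ZigFree (D ∷ w)
zigFree-D∷ zf z (_ , _ , refl) ([] , _ , ())
zigFree-D∷ zf z dz (_ ∷ p , q , eq) = zf z dz (p , q , ∷-injectiveʳ eq)

zigFree-U∷ : ∀ {N} → ZigFree N → (∀ Z → N ≢ D ∷ D ∷ Z) → ZigFree (U ∷ N)
zigFree-U∷ zf notDD z (_ , s≤s (s≤s _) , refl) ([] , q , eq) = notDD _ (∷-injectiveʳ eq)
zigFree-U∷ zf notDD z dz (_ ∷ p , q , eq) = zf z dz (p , q , ∷-injectiveʳ eq)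

zigFree-U∷-or-DD : ∀ N → ZigFree N → ZigFree (U ∷ N) ⊎ Σ Word λ Z → N ≡ D ∷ D ∷ Z
zigFree-U∷-or-DD (D ∷ D ∷ Z) _  = inj₂ (Z , refl)
zigFree-U∷-or-DD []          zf = inj₁ (zigFree-U∷ zf λ _ ())
zigFree-U∷-or-DD (U ∷ _)     zf = inj₁ (zigFree-U∷ zf λ _ ())
zigFree-U∷-or-DD (D ∷ [])    zf = inj₁ (zigFree-U∷ zf λ _ ())
zigFree-U∷-or-DD (D ∷ U ∷ _) zf = inj₁ (zigFree-U∷ zf λ _ ())

factor-∷ʳ : ∀ z {w c d} → c ≢ d → Factor (z ∷ʳ c) (w ∷ʳ d) → Factor (z ∷ʳ c) w
factor-∷ʳ z {w} {c} c≢d (p , q , eq) with initLast q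
... | [] = ⊥-elim (c≢d (sym (proj₂ (∷ʳ-injective w (p ++ z) (begin
  w ∷ʳ _                       ≡⟨ eq ⟩
  p ++ (z ∷ʳ c) ++ []          ≡⟨ cong (p ++_) (++-identityʳ _) ⟩
  p ++ z ∷ʳ c                  ≡⟨ ++-assoc p z _ ⟨
  (p ++ z) ∷ʳ c                ∎)))))
... | q′ ∷ʳ′ d′ = p , q′ , proj₁ (∷ʳ-injective w _ (begin
  w ∷ʳ _                       ≡⟨ eq ⟩
  p ++ (z ∷ʳ c) ++ q′ ∷ʳ d′    ≡⟨ cong (p ++_) (++-assoc (z ∷ʳ c) q′ _) ⟨
  p ++ ((z ∷ʳ c) ++ q′) ∷ʳ d′  ≡⟨ ++-assoc p _ _ ⟨
  (p ++ (z ∷ʳ c) ++ q′) ∷ʳ d′  ∎))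

zigFree-∷ʳD : ∀ {N} → ZigFree N → ZigFree (N ∷ʳ D)
zigFree-∷ʳD zf z dz@(k , _ , refl) fac = zf z dz (factor-∷ʳ (U ∷ replicate k D) (λ ()) fac)

replicate-++-∷ : ∀ {A : Set} n (x : A) xs → replicate n x ++ x ∷ xs ≡ x ∷ replicate n x ++ xs
replicate-++-∷ zero    x xs = refl
replicate-++-∷ (suc n) x xs = cong (x ∷_) (replicate-++-∷ n x xs)

zigFree-UDᵏ-noU : ∀ k v → 2 ≤ k → ZigFree (U ∷ replicate k D ++ v) → #U v ≡ 0
zigFree-UDᵏ-noU k []      _   _  = refl
zigFree-UDᵏ-noU k (D ∷ v) 2≤k zf = zigFree-UDᵏ-noU (suc k) v (ℕP.m≤n⇒m≤1+n 2≤k)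
  (subst (λ u → ZigFree (U ∷ u)) (replicate-++-∷ k D v) zf)
zigFree-UDᵏ-noU k (U ∷ v) 2≤k zf = ⊥-elim (zf _ (k , 2≤k , refl)
  ([] , v , cong (U ∷_) (sym (++-assoc (replicate k D) (U ∷ []) v))))

ups-noU : ∀ s v j → #U v ≡ 0 → ups s v j ≡ 0
ups-noU s []      j _    = refl
ups-noU s (D ∷ v) j noU = ups-noU (ℤ.pred s) v j noU

ups-U∷≢0 : ∀ s w → ups s (U ∷ w) s ≢ 0
ups-U∷≢0 s w = ℕP.1+n≢0 ∘ trans (sym (cong (_+ ups (ℤ.suc s) w s) (δ-refl s)))

mutual
  zigFree-ups-below : ∀ w {s j} → ZigFree (U ∷ w) → j ℤ.< s → ups s (U ∷ w) j ≡ 0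
  zigFree-ups-below w zf j<s =
    cong₂ _+_ (δ-≢ (≢-sym (ℤP.<⇒≢ j<s))) (zigFree-ups-below-after w zf j<s)

  zigFree-ups-below-after : ∀ w {s j} → ZigFree (U ∷ w) → j ℤ.< s → ups (ℤ.suc s) w j ≡ 0
  zigFree-ups-below-after []          _  _   = refl
  zigFree-ups-below-after (U ∷ w) {s} zf j<s =
    zigFree-ups-below w (zigFree-tail U zf) (ℤP.<-≤-trans j<s (ℤP.i≤suc[i] s))
  zigFree-ups-below-after (D ∷ [])    _  _   = refl
  zigFree-ups-below-after (D ∷ U ∷ w) {s} {j} zf j<s =
    trans (cong (λ h → ups h (U ∷ w) j) (ℤP.pred-suc s))
          (zigFree-ups-below w (zigFree-tail D (zigFree-tail U zf)) j<s)
  zigFree-ups-below-after (D ∷ D ∷ w) zf _ = ups-noU _ w _ (zigFree-UDᵏ-noU 2 w ℕP.≤-refl zf)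

ups-vanish : ∀ v s → (∀ j → j ℤ.≤ s → ups s v j ≡ 0) → ∀ j → ups s v j ≡ 0
ups-vanish []      s _    j = refl
ups-vanish (D ∷ v) s none j =
  ups-vanish v (ℤ.pred s) (λ i i≤s-1 → none i (ℤP.<⇒≤ (ℤP.i≤pred[j]⇒i<j i≤s-1))) j
ups-vanish (U ∷ v) s none j = ⊥-elim (ups-U∷≢0 s v (none s ℤP.≤-refl))

ups-D∷≢ups-U∷ : ∀ t t′ s → ZigFree (U ∷ t′) → ¬ (∀ j → ups s (D ∷ t) j ≡ ups s (U ∷ t′) j)
ups-D∷≢ups-U∷ t t′ s zf same =
  ups-U∷≢0 s t′ (trans (sym (same s)) (ups-vanish t (ℤ.pred s) below s))
  where
  below : ∀ j → j ℤ.≤ ℤ.pred s → ups (ℤ.pred s) t j ≡ 0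
  below j j≤s-1 = trans (same j) (zigFree-ups-below t′ {s} zf (ℤP.i≤pred[j]⇒i<j j≤s-1))

zigFree-ups-injective : ∀ {t t′} s → ZigFree t → ZigFree t′ → #D t ≡ #D t′ →
  (∀ j → ups s t j ≡ ups s t′ j) → t ≡ t′
zigFree-ups-injective {[]}     {[]}      s _  _   _  _    = refl
zigFree-ups-injective {[]}     {U ∷ t′}  s _  _   _  same = ⊥-elim (ups-U∷≢0 s t′ (sym (same s)))
zigFree-ups-injective {U ∷ t}  {[]}      s _  _   _  same = ⊥-elim (ups-U∷≢0 s t (same s))
zigFree-ups-injective {D ∷ t}  {D ∷ t′}  s zf zf′ #D≡ same =
  cong (D ∷_) (zigFree-ups-injective (ℤ.pred s) (zigFree-tail D zf) (zigFree-tail D zf′)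
    (ℕP.suc-injective #D≡) same)
zigFree-ups-injective {U ∷ t}  {U ∷ t′}  s zf zf′ #D≡ same =
  cong (U ∷_) (zigFree-ups-injective (ℤ.suc s) (zigFree-tail U zf) (zigFree-tail U zf′) #D≡
    (λ j → ℕP.+-cancelˡ-≡ (δ s j) _ _ (same j)))
zigFree-ups-injective {D ∷ t}  {U ∷ t′}  s _  zf′ _  same = ⊥-elim (ups-D∷≢ups-U∷ t t′ s zf′ same)
zigFree-ups-injective {U ∷ t}  {D ∷ t′}  s zf _   _  same =
  ⊥-elim (ups-D∷≢ups-U∷ t′ t s zf (λ j → sym (same j)))

zigFree-∼bal-unique : ∀ {t t′} → ZigFree t → ZigFree t′ → t ∼bal t′ → t ≡ t′
zigFree-∼bal-unique zf zf′ t∼t′ =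
  zigFree-ups-injective 0ℤ zf zf′ (#D-∼bal t∼t′) (ups-∼bal t∼t′ 0ℤ)

ZigFreeForm : Word → Set
ZigFreeForm w = Σ Word λ t → ZigFree t × t ∼bal w

zigFreeForm-∼bal : ∀ {u w} → u ∼bal w → ZigFreeForm u → ZigFreeForm w
zigFreeForm-∼bal u∼w (t , zf , t∼u) = t , zf , t∼u ◅◅ u∼w

zigFreeForm-D∷ : ∀ {w} → ZigFreeForm w → ZigFreeForm (D ∷ w)
zigFreeForm-D∷ (t , zf , t∼w) = D ∷ t , zigFree-D∷ zf , ∷-∼bal D t∼w

zigFreeForm-∷ʳD : ∀ {w} → ZigFreeForm w → ZigFreeForm (w ∷ʳ D)
zigFreeForm-∷ʳD (t , zf , t∼w) = t ∷ʳ D , zigFree-∷ʳD zf , ++ʳ-∼bal (D ∷ []) t∼w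

FormsBelow : Word → Set
FormsBelow w = ∀ {v} → length v < length w → Rising v → ZigFreeForm v

descent-form : ∀ Z {w} → (U ∷ D ∷ D ∷ Z) ∼bal w → Rising w → FormsBelow w → ZigFreeForm w
descent-form Z {w} UDDZ∼w r below with split-first-excess-U 0 Z (s≤s⁻¹ (rising-∼bal UDDZ∼w r))
... | Q , Z′ , refl , exc =
  zigFreeForm-∼bal DV∼w (zigFreeForm-D∷ (below shorter (ℕP.<⇒≤ (rising-∼bal DV∼w r))))
  where
  DV∼w : (D ∷ Q ++ U ∷ U ∷ D ∷ Z′) ∼bal w
  DV∼w = descent-commutation Q Z′ (sym exc) ◅ UDDZ∼w
  shorter : length (Q ++ U ∷ U ∷ D ∷ Z′) < length w
  shorter = ℕP.≤-reflexive (length-∼bal DV∼w)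

rotation-form : ∀ B v → Balanced B → Balanced (U ∷ B ++ D ∷ v) →
  FormsBelow (U ∷ B ++ D ∷ v) → ZigFreeForm (U ∷ B ++ D ∷ v)
rotation-form B v bal-B bal-w below =
  zigFreeForm-∼bal Y∼w
    (zigFreeForm-∷ʳD (below shorter (balanced-∷ʳD⇒rising Y (balanced-∼bal Y∼w bal-w))))
  where
  bal-v : Balanced v
  bal-v = balanced-++⁻ʳ (U ∷ B ∷ʳ D) v (balanced-U∷-∷ʳD B bal-B)
    (subst Balanced (cong (U ∷_) (sym (++-assoc B (D ∷ []) v))) bal-w)
  Y : Word
  Y = v ++ U ∷ B
  Y∼w : (Y ∷ʳ D) ∼bal (U ∷ B ++ D ∷ v)
  Y∼w = rotation-commutation B v bal-B bal-v ◅ ε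
  shorter : length Y < length (U ∷ B ++ D ∷ v)
  shorter = ℕP.≤-reflexive (begin
    suc (length Y)           ≡⟨ ℕP.+-comm 1 (length Y) ⟩
    length Y + 1             ≡⟨ length-++ Y ⟨
    length (Y ∷ʳ D)          ≡⟨ length-∼bal Y∼w ⟩
    length (U ∷ B ++ D ∷ v)  ∎)

zigFreeForm-U∷ : ∀ {X} → ZigFreeForm X → Rising (U ∷ X) → FormsBelow (U ∷ X) → ZigFreeForm (U ∷ X)
zigFreeForm-U∷ (N , zf , N∼X) r below with zigFree-U∷-or-DD N zf
... | inj₁ zf′        = U ∷ N , zf′ , ∷-∼bal U N∼X
... | inj₂ (Z , refl) = descent-form Z (∷-∼bal U N∼X) r below

zigFreeForm-step : ∀ w → FormsBelow w → Rising w → ZigFreeForm w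
zigFreeForm-step []      _     _ = [] , zigFree-[] , ε
zigFreeForm-step (D ∷ X) below r = zigFreeForm-D∷ (below ℕP.≤-refl (ℕP.<⇒≤ r))
zigFreeForm-step (U ∷ X) below r with #D X ℕP.≤? #U X
... | yes rX = zigFreeForm-U∷ (below ℕP.≤-refl rX) r below
... | no ¬rX with split-first-excess-D 0 X (ℕP.≰⇒> ¬rX)
...   | B , v , refl , bal-B = rotation-form B v bal-B (ℕP.≤-antisym r (ℕP.≰⇒> ¬rX)) below

zigFreeForm : ∀ w → Rising w → ZigFreeForm w
zigFreeForm =
  All.wfRec (On.wellFounded length <-wellFounded) _ (λ w → Rising w → ZigFreeForm w) zigFreeForm-step

proposition4p4 : (w : Word) → Rising w →
    Σ Word (λ t → UpNormal t × t ∼bal w × ((t′ : Word) → UpNormal t′ → t′ ∼bal w → t′ ≡ t))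
proposition4p4 w r with zigFreeForm w r
... | t , zf , t∼w = t , (rising-∼bal t∼w r , zf) , t∼w ,
  λ t′ (_ , zf′) t′∼w → zigFree-∼bal-unique zf′ zf (t′∼w ◅◅ ∼bal-sym t∼w)
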